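{- For any positive integer $K$ and any integer $\delta\ge 2$, there exists a finite simple graph $G$ with minimum degree $\delta(G)=\delta$ and $\mathrm{Maj}(G)\ge K$.
   Context: Graphs are finite, simple and undirected. A strong majority vertex-coloring of a graph $G=(V,E)$ is a (not necessarily proper) map $c:V\to C$ into a set $C$ of colors such that for every vertex $v\in V$ and every color $\alpha\in C$, at most half of the neighbors of $v$ have color $\alpha$. The strong majority number $\mathrm{Maj}(G)$ is the least number of colors in such a coloring; it is defined for graphs with minimum degree at least $2$. -}

module Defs where

open import Data.Nat using (ℕ; zero; suc; _+_; _*_; _≤_)
open import Data.Bool using (Bool; true; false; _∧_)
open import Data.Fin using (Fin; zero; suc)
open import Data.Fin.Properties using (_≟_)
open import Data.Product using (Σ; _×_; ∃)
open import Relation.Nullary.Decidable using (⌊_⌋)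
open import Relation.Binary.PropositionalEquality using (_≡_)

count : {n : ℕ} → (Fin n → Bool) → ℕ
count {zero}  p = 0
count {suc n} p with p zero
... | true  = suc (count (λ i → p (suc i)))
... | false = count (λ i → p (suc i))

record Graph (n : ℕ) : Set where
  field
    adj   : Fin n → Fin n → Bool
    sym   : ∀ u v → adj u v ≡ adj v u
    irrefl : ∀ v → adj v v ≡ false
open Graph public

degree : {n : ℕ} → Graph n → Fin n → ℕ
degree G v = count (adj G v)

MinDegree : {n : ℕ} → Graph n → ℕ → Set
MinDegree G d = (∀ v → d ≤ degree G v) × ∃ (λ v → degree G v ≡ d)

colourDegree : {n k : ℕ} → Graph n → (Fin n → Fin k) → Fin n → Fin k → ℕ
colourDegree G c v α = count (λ u → adj G v u ∧ ⌊ c u ≟ α ⌋)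

IsStrongMajorityColouring : {n k : ℕ} → Graph n → (Fin n → Fin k) → Set
IsStrongMajorityColouring G c =
  ∀ v α → 2 * colourDegree G c v α ≤ degree G v

MajAtLeast : {n : ℕ} → Graph n → ℕ → Set
MajAtLeast {n} G K =
  ∀ (k : ℕ) (c : Fin n → Fin k) → IsStrongMajorityColouring G c → K ≤ k

{-# OPTIONS --safe #-}
-- Let A be a clique on m = (K + 1)δ vertices and add, for every subset S of A, one vertex
-- adjacent to S if |S| ≥ δ and to all of A otherwise. Every degree is at least δ, and the vertex
-- attached to a δ-element subset has degree exactly δ. A colouring with k < K colours has kδ < m,
-- so by pigeonhole some colour class S ⊆ A has more than δ elements; all neighbours of the vertex
-- attached to S then share one colour, violating the strong majority condition.
module Submission where

open import Defs hiding (sym)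
open import Data.Nat using (ℕ; zero; suc; pred; _+_; _*_; _^_; _≤_; _<_; _<ᵇ_; z≤n; s≤s; _≤?_; _<?_)
open import Data.Nat.Properties
  using (≤-refl; ≤-trans; ≤-reflexive; m≤n⇒m≤1+n; +-monoʳ-≤; +-mono-≤; +-suc; +-comm; *-mono-≤; *-monoˡ-≤;
         m≤m+n; m<m+n; m<n+m; <⇒≤; <⇒≱; ≰⇒>; ≮⇒≥; <⇒≤pred; m≤n⇒m<n∨m≡n; <ᵇ⇒<; <⇒<ᵇ; ≤-pred;
         ≤-<-trans; +-identityʳ; module ≤-Reasoning)
open import Data.Bool using (Bool; true; false; T; not; _∧_; _∨_)
open import Data.Bool.Properties using (T-∨; T-≡)
open import Data.Fin using (Fin; zero; suc; toℕ; fromℕ<; splitAt; _↑ˡ_; _↑ʳ_; finToFun; funToFin)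
open import Data.Fin.Properties
  using (_≟_; any?; toℕ-injective; toℕ-fromℕ<; toℕ<n; splitAt-↑ˡ; splitAt-↑ʳ; splitAt⁻¹-↑ˡ;
         finToFun-funToFin; 2↔Bool)
open import Data.Product using (Σ; _×_; ∃; _,_; uncurry)
open import Data.Sum using (_⊎_; inj₁; inj₂)
open import Data.Unit using (tt)
open import Function using (_∘_; Inverse; Equivalence)
open import Relation.Nullary using (¬_; yes; no; does; contradiction)
open import Relation.Nullary.Decidable using (⌊_⌋; fromWitness; toWitness; dec-true; dec-false)
open import Relation.Binary.PropositionalEquality
  using (_≡_; refl; sym; trans; cong; cong₂; cong-app; subst; module ≡-Reasoning)

count-cong : ∀ {n} {p q : Fin n → Bool} → (∀ i → p i ≡ q i) → count p ≡ count q
count-cong {zero}          _   = refl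
count-cong {suc n} {p} {q} p≗q with p zero | q zero | p≗q zero
... | true  | true  | _ = cong suc (count-cong (p≗q ∘ suc))
... | false | false | _ = count-cong (p≗q ∘ suc)

count-all : ∀ {n} {p : Fin n → Bool} → (∀ i → T (p i)) → count p ≡ n
count-all {zero}      _  = refl
count-all {suc n} {p} all with p zero | all zero
... | true | _ = cong suc (count-all (all ∘ suc))

count-none : ∀ {n} {p : Fin n → Bool} → (∀ i → ¬ T (p i)) → count p ≡ 0
count-none {zero}       _    = refl
count-none {suc n} {p} none with p zero | none zero
... | false | _   = count-none (none ∘ suc)
... | true  | ¬tt = contradiction tt ¬tt

count-mono : ∀ {n} {p q : Fin n → Bool} → (∀ i → T (p i) → T (q i)) → count p ≤ count q
count-mono {zero}          _   = z≤n
count-mono {suc n} {p} {q} p⊆q with p zero | q zero | p⊆q zero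
... | true  | true  | _   = s≤s (count-mono (p⊆q ∘ suc))
... | true  | false | p⊆q₀ = contradiction (p⊆q₀ tt) λ ()
... | false | true  | _   = m≤n⇒m≤1+n (count-mono (p⊆q ∘ suc))
... | false | false | _   = count-mono (p⊆q ∘ suc)

count-∨ : ∀ {n} (p q : Fin n → Bool) → count (λ i → p i ∨ q i) ≤ count p + count q
count-∨ {zero}  p q = z≤n
count-∨ {suc n} p q with p zero | q zero
... | true  | true  = s≤s (≤-trans (count-∨ (p ∘ suc) (q ∘ suc)) (+-monoʳ-≤ (count (p ∘ suc)) (m≤n⇒m≤1+n ≤-refl)))
... | true  | false = s≤s (count-∨ (p ∘ suc) (q ∘ suc))
... | false | true  = subst (suc (count (λ i → p (suc i) ∨ q (suc i))) ≤_)
                            (sym (+-suc (count (p ∘ suc)) (count (q ∘ suc))))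
                            (s≤s (count-∨ (p ∘ suc) (q ∘ suc)))
... | false | false = count-∨ (p ∘ suc) (q ∘ suc)

count-↑ˡ-↑ʳ : ∀ m {n} (p : Fin (m + n) → Bool) → count p ≡ count (p ∘ (_↑ˡ n)) + count (p ∘ (m ↑ʳ_))
count-↑ˡ-↑ʳ zero    p = refl
count-↑ˡ-↑ʳ (suc m) p with p zero
... | true  = cong suc (count-↑ˡ-↑ʳ m (p ∘ suc))
... | false = count-↑ˡ-↑ʳ m (p ∘ suc)

-- Stated with does rather than ⌊_⌋: only does (suc a ≟ suc b) reduces to does (a ≟ b).
count-≢ : ∀ {n} (a : Fin n) → count (λ b → not (does (a ≟ b))) ≡ pred n
count-≢ {suc n}       zero    = count-all {n} (λ _ → tt)
count-≢ {suc (suc n)} (suc a) = cong suc (count-≢ {suc n} a)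

count-toℕ< : ∀ {n} d → d ≤ n → count {n} (λ a → toℕ a <ᵇ d) ≡ d
count-toℕ< {n}     zero    _         = count-none {n} λ _ ()
count-toℕ< {suc n} (suc d) (s≤s d≤n) = cong suc (count-toℕ< d d≤n)

module _ {m k : ℕ} (c : Fin m → Fin k) where

  colourClass : Fin k → Fin m → Bool
  colourClass α a = ⌊ c a ≟ α ⌋

  private
    colouredBelow : ℕ → Fin m → Bool
    colouredBelow j a = toℕ (c a) <ᵇ j

    colouredBelow-suc : ∀ {j} (j<k : j < k) a →
      T (colouredBelow (suc j) a) → T (colouredBelow j a ∨ colourClass (fromℕ< j<k) a)
    colouredBelow-suc {j} j<k a below with m≤n⇒m<n∨m≡n (≤-pred (<ᵇ⇒< (toℕ (c a)) (suc j) below))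
    ... | inj₁ lt = Equivalence.from (T-∨ {colouredBelow j a}) (inj₁ (<⇒<ᵇ lt))
    ... | inj₂ eq = Equivalence.from (T-∨ {colouredBelow j a})
                      (inj₂ (fromWitness (toℕ-injective (trans eq (sym (toℕ-fromℕ< j<k))))))

    count-colouredBelow : ∀ {d} → (∀ α → count (colourClass α) ≤ d) →
                          ∀ j → j ≤ k → count (colouredBelow j) ≤ j * d
    count-colouredBelow         small zero    _   = ≤-reflexive (count-none {m} λ _ ())
    count-colouredBelow {d} small (suc j) j<k = begin
      count (colouredBelow (suc j))                                  ≤⟨ count-mono (colouredBelow-suc j<k) ⟩
      count (λ a → colouredBelow j a ∨ colourClass (fromℕ< j<k) a)  ≤⟨ count-∨ (colouredBelow j) _ ⟩
      count (colouredBelow j) + count (colourClass (fromℕ< j<k))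
        ≤⟨ +-mono-≤ (count-colouredBelow small j (<⇒≤ j<k)) (small _) ⟩
      j * d + d                                                      ≡⟨ +-comm (j * d) d ⟩
      suc j * d                                                      ∎
      where open ≤-Reasoning

  pigeonhole : ∀ d → k * d < m → ∃ λ α → d < count (colourClass α)
  pigeonhole d kd<m with any? (λ α → d <? count (colourClass α))
  ... | yes large = large
  ... | no ¬large = contradiction m≤kd (<⇒≱ kd<m)
    where
    m≤kd : m ≤ k * d
    m≤kd = subst (_≤ k * d) (count-all (λ a → <⇒<ᵇ (toℕ<n (c a))))
                 (count-colouredBelow (λ α → ≮⇒≥ (¬large ∘ (α ,_))) k ≤-refl)

does-≟-comm : ∀ {n} (a b : Fin n) → does (a ≟ b) ≡ does (b ≟ a)
does-≟-comm a b with a ≟ b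
... | yes refl = sym (dec-true (a ≟ a) refl)
... | no  a≢b  = sym (dec-false (b ≟ a) (a≢b ∘ sym))

module _ {m : ℕ} where
  open Inverse 2↔Bool using (to; from; strictlyInverseˡ)

  membersOf : Fin (2 ^ m) → Fin m → Bool
  membersOf s = to ∘ finToFun s

  codeOf : (Fin m → Bool) → Fin (2 ^ m)
  codeOf S = funToFin (from ∘ S)

  membersOf-codeOf : ∀ S a → membersOf (codeOf S) a ≡ S a
  membersOf-codeOf S a = trans (cong to (finToFun-funToFin (from ∘ S) a)) (strictlyInverseˡ (S a))

fillIfSmall : ∀ {m} → ℕ → (Fin m → Bool) → Fin m → Bool
fillIfSmall δ S with δ ≤? count S
... | yes _ = S
... | no  _ = λ _ → true

fillIfSmall-large : ∀ {m δ} {S : Fin m → Bool} → δ ≤ count S → fillIfSmall δ S ≡ S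
fillIfSmall-large {δ = δ} {S} large with δ ≤? count S
... | yes _     = refl
... | no  small = contradiction large small

δ≤count-fillIfSmall : ∀ {m δ} (S : Fin m → Bool) → δ ≤ m → δ ≤ count (fillIfSmall δ S)
δ≤count-fillIfSmall {δ = δ} S δ≤m with δ ≤? count S
... | yes large = large
... | no  _     = subst (δ ≤_) (sym (count-all λ _ → tt)) δ≤m

module _ {m n : ℕ} (R : Fin m ⊎ Fin n → Fin m ⊎ Fin n → Bool) where

  degreeOnSum : Fin m ⊎ Fin n → ℕ
  degreeOnSum x = count (R x ∘ inj₁) + count (R x ∘ inj₂)

  module _ (R-sym : ∀ x y → R x y ≡ R y x) (R-irrefl : ∀ x → R x x ≡ false) where

    graphOnSum : Graph (m + n)
    graphOnSum = record
      { adj    = λ u v → R (splitAt m u) (splitAt m v)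
      ; sym    = λ u v → R-sym (splitAt m u) (splitAt m v)
      ; irrefl = λ v → R-irrefl (splitAt m v)
      }

    degree-graphOnSum : ∀ v → degree graphOnSum v ≡ degreeOnSum (splitAt m v)
    degree-graphOnSum v = trans (count-↑ˡ-↑ʳ m _) (cong₂ _+_
      (count-cong λ a → cong (R (splitAt m v)) (splitAt-↑ˡ m a n))
      (count-cong λ b → cong (R (splitAt m v)) (splitAt-↑ʳ m n b)))

module _ {n k : ℕ} (G : Graph n) (c : Fin n → Fin k) {v : Fin n} {α : Fin k}
         (monochromatic : ∀ u → T (adj G v u) → c u ≡ α) where

  colourDegree-monochromatic : colourDegree G c v α ≡ degree G v
  colourDegree-monochromatic = count-cong coloured
    where
    coloured : ∀ u → (adj G v u ∧ ⌊ c u ≟ α ⌋) ≡ adj G v u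
    coloured u with adj G v u in uv
    ... | false = refl
    ... | true  = Equivalence.to T-≡ (fromWitness (monochromatic u (Equivalence.from T-≡ uv)))

  ¬strongMajority-monochromatic : 0 < degree G v → ¬ IsStrongMajorityColouring G c
  ¬strongMajority-monochromatic positive strong =
    <⇒≱ (m<m+n d (≤-trans positive (m≤m+n d 0)))
        (subst (λ x → 2 * x ≤ d) colourDegree-monochromatic (strong v α))
    where d = degree G v

module Construction (m δ : ℕ) where

  neighbourhood : Fin (2 ^ m) → Fin m → Bool
  neighbourhood s = fillIfSmall δ (membersOf s)

  adjacent : Fin m ⊎ Fin (2 ^ m) → Fin m ⊎ Fin (2 ^ m) → Bool
  adjacent (inj₁ a) (inj₁ b) = not (does (a ≟ b))
  adjacent (inj₁ a) (inj₂ s) = neighbourhood s a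
  adjacent (inj₂ s) (inj₁ a) = neighbourhood s a
  adjacent (inj₂ _) (inj₂ _) = false

  adjacent-sym : ∀ x y → adjacent x y ≡ adjacent y x
  adjacent-sym (inj₁ a) (inj₁ b) = cong not (does-≟-comm a b)
  adjacent-sym (inj₁ a) (inj₂ s) = refl
  adjacent-sym (inj₂ s) (inj₁ a) = refl
  adjacent-sym (inj₂ _) (inj₂ _) = refl

  adjacent-irrefl : ∀ x → adjacent x x ≡ false
  adjacent-irrefl (inj₁ a) = cong not (dec-true (a ≟ a) refl)
  adjacent-irrefl (inj₂ _) = refl

  graph : Graph (m + 2 ^ m)
  graph = graphOnSum adjacent adjacent-sym adjacent-irrefl

  degree-graph : ∀ v → degree graph v ≡ degreeOnSum adjacent (splitAt m v)
  degree-graph = degree-graphOnSum adjacent adjacent-sym adjacent-irrefl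

  degree-subsetVertex : ∀ s → degree graph (m ↑ʳ s) ≡ count (neighbourhood s)
  degree-subsetVertex s = begin
    degree graph (m ↑ʳ s)                      ≡⟨ degree-graph (m ↑ʳ s) ⟩
    degreeOnSum adjacent (splitAt m (m ↑ʳ s))  ≡⟨ cong (degreeOnSum adjacent) (splitAt-↑ʳ m (2 ^ m) s) ⟩
    count (neighbourhood s) + count {2 ^ m} (λ _ → false)
                                               ≡⟨ cong (count (neighbourhood s) +_) (count-none {2 ^ m} λ _ ()) ⟩
    count (neighbourhood s) + 0                ≡⟨ +-identityʳ _ ⟩
    count (neighbourhood s)                    ∎
    where open ≡-Reasoning

  adj-subsetVertex : ∀ s u → T (adj graph (m ↑ʳ s) u) →
                     ∃ λ a → T (neighbourhood s a) × u ≡ a ↑ˡ 2 ^ m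
  adj-subsetVertex s u s~u rewrite splitAt-↑ʳ m (2 ^ m) s with splitAt m u in eq
  ... | inj₁ a = a , s~u , sym (splitAt⁻¹-↑ˡ eq)

  neighbourhood-codeOf : ∀ S → δ ≤ count S → ∀ a → neighbourhood (codeOf S) a ≡ S a
  neighbourhood-codeOf S large a =
    trans (cong-app (fillIfSmall-large (subst (δ ≤_) (sym (count-cong (membersOf-codeOf S))) large)) a)
          (membersOf-codeOf S a)

  degree-codeOf : ∀ S → δ ≤ count S → degree graph (m ↑ʳ codeOf S) ≡ count S
  degree-codeOf S large = trans (degree-subsetVertex (codeOf S)) (count-cong (neighbourhood-codeOf S large))

  δ≤degree : δ < m → ∀ v → δ ≤ degree graph v
  δ≤degree δ<m v = subst (δ ≤_) (sym (degree-graph v)) (bound (splitAt m v))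
    where
    bound : ∀ x → δ ≤ degreeOnSum adjacent x
    bound (inj₁ a) = ≤-trans (subst (δ ≤_) (sym (count-≢ a)) (<⇒≤pred δ<m)) (m≤m+n _ _)
    bound (inj₂ s) = ≤-trans (δ≤count-fillIfSmall (membersOf s) (<⇒≤ δ<m)) (m≤m+n _ _)

  minDegree : δ < m → MinDegree graph δ
  minDegree δ<m = δ≤degree δ<m , (m ↑ʳ codeOf firstδ , degree-firstδ)
    where
    firstδ : Fin m → Bool
    firstδ a = toℕ a <ᵇ δ
    countFirstδ : count firstδ ≡ δ
    countFirstδ = count-toℕ< δ (<⇒≤ δ<m)
    degree-firstδ : degree graph (m ↑ʳ codeOf firstδ) ≡ δ
    degree-firstδ = trans (degree-codeOf firstδ (≤-reflexive (sym countFirstδ))) countFirstδ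

  ¬strongMajority-largeCliqueClass : ∀ {k} (c : Fin (m + 2 ^ m) → Fin k) α →
    δ < count (colourClass (c ∘ (_↑ˡ 2 ^ m)) α) → ¬ IsStrongMajorityColouring graph c
  ¬strongMajority-largeCliqueClass c α large = ¬strongMajority-monochromatic graph c monochromatic positive
    where
    S : Fin m → Bool
    S = colourClass (c ∘ (_↑ˡ 2 ^ m)) α
    positive : 0 < degree graph (m ↑ʳ codeOf S)
    positive = subst (0 <_) (sym (degree-codeOf S (<⇒≤ large))) (≤-trans (s≤s z≤n) large)
    monochromatic : ∀ u → T (adj graph (m ↑ʳ codeOf S) u) → c u ≡ α
    monochromatic u s~u with adj-subsetVertex (codeOf S) u s~u
    ... | a , a∈S , refl = toWitness (subst T (neighbourhood-codeOf S (<⇒≤ large) a) a∈S)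

  majAtLeast : ∀ K → K * δ < m → MajAtLeast graph K
  majAtLeast K Kδ<m k c strong with K ≤? k
  ... | yes K≤k = K≤k
  ... | no  K≰k = contradiction strong
      (uncurry (¬strongMajority-largeCliqueClass c) (pigeonhole (c ∘ (_↑ˡ 2 ^ m)) δ kδ<m))
    where
    kδ<m : k * δ < m
    kδ<m = ≤-<-trans (*-monoˡ-≤ δ (<⇒≤ (≰⇒> K≰k))) Kδ<m

theorem6 : (K δ : ℕ) → 1 ≤ K → 2 ≤ δ →
    Σ ℕ (λ n → Σ (Graph n) (λ G → MinDegree G δ × MajAtLeast G K))
theorem6 K δ 1≤K 2≤δ = m + 2 ^ m , graph , minDegree δ<m , majAtLeast K Kδ<m
  where
  m : ℕ
  m = suc K * δ
  open Construction m δ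
  1≤δ : 1 ≤ δ
  1≤δ = ≤-trans (s≤s z≤n) 2≤δ
  δ<m : δ < m
  δ<m = m<m+n δ (*-mono-≤ 1≤K 1≤δ)
  Kδ<m : K * δ < m
  Kδ<m = m<n+m (K * δ) 1≤δ
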